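{- Let $w \in \mathfrak{S}_n$ and $k \in [1,n-1]$. Then $$\max\nolimits_k(w) \le \min\big\{\mathsf{ValPair}_k(w),\mathsf{PosPair}_k(w)\big\} + 1.$$
   Context: $\mathfrak{S}_n$ is the symmetric group on $[1,n]$, written in one-line notation $w=w(1)\cdots w(n)$; $\sigma_i$ is the simple reflection exchanging $i$ and $i+1$. $\max_k(w)$ is the maximum, over all reduced decompositions (minimal-length expressions as products of simple reflections) of $w$, of the number of occurrences of the factor $\sigma_k$. An occurrence of $321$ is a triple of positions $i_1<i_2<i_3$ with $w(i_1)>w(i_2)>w(i_3)$; an occurrence of $3412$ is a quadruple of positions $i_1<i_2<i_3<i_4$ with $w(i_3)<w(i_4)<w(i_1)<w(i_2)$. Position and value pairs at $k$: (1) if $w$ has a $321$-occurrence in positions $i_1<i_2<i_3$ with $i_1\le k<i_3$, then $(i_1,i_3)$ is a position pair at $k$; (2) if $w$ has a $321$-occurrence with values $j_1<j_2<j_3$ with $j_1\le k<j_3$, then $(j_3,j_1)$ is a value pair at $k$; (3) if $w$ has a $3412$-occurrence in positions $i_1<i_2\le k<i_3<i_4$, then $(i_2,i_3)$ is a position pair at $k$; (4) if $w$ has a $3412$-occurrence with values $j_1<j_2\le k<j_3<j_4$, then $(j_4,j_1)$ is a value pair at $k$. $\mathsf{PosPair}_k(w)$ is the number of distinct position pairs at $k$ in $w$, and $\mathsf{ValPair}_k(w)$ is the number of distinct value pairs at $k$ in $w$ (a pair arising from several occurrences is counted once). -}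

module Defs where

open import Data.Nat using (ℕ; zero; suc; _+_; _≤_; _<_; _⊔_; _⊓_; _≤ᵇ_; _<ᵇ_; _≡ᵇ_)
open import Data.Bool using (Bool; true; false; _∧_; _∨_; if_then_else_)
open import Data.Fin using (Fin; toℕ)
open import Data.Fin.Permutation using (Permutation′; _⟨$⟩ʳ_)
open import Data.List using (List; []; _∷_; length; filter; allFin; cartesianProduct)
open import Data.Bool.ListAction using (any)
open import Data.List.Relation.Unary.All using (All)
open import Data.Product using (_×_; _,_)
open import Relation.Binary.PropositionalEquality using (_≡_)
open import Relation.Nullary.Decidable using (does)
open import Data.Bool using (T)

-- Conventions: positions and values of w ∈ 𝔖_n are represented by Fin n
-- (0-based); the 1-based position/value of i : Fin n is  toℕ i + 1.
-- So "1-based i ≤ k" is  toℕ i < k  and "k < 1-based j" is  k ≤ toℕ j.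

val : {n : ℕ} → Permutation′ n → Fin n → ℕ
val w i = toℕ (w ⟨$⟩ʳ i)

swapℕ : ℕ → ℕ → ℕ
swapℕ a x = if x ≡ᵇ a then suc a else (if x ≡ᵇ suc a then a else x)

-- a word a₁ a₂ … a_m (letters in [1,n-1]) denotes σ_{a₁} σ_{a₂} ⋯ σ_{a_m},
-- product = composition of maps ((uv)(i) = u(v(i))); evaluated in
-- one-line notation at (0-based) position i, giving a 1-based value.
evalWord : {n : ℕ} → List ℕ → Fin n → ℕ
evalWord []       i = suc (toℕ i)
evalWord (a ∷ as) i = swapℕ a (evalWord as i)

IsExpression : {n : ℕ} → Permutation′ n → List ℕ → Set
IsExpression {n} w ws =
  All (λ a → 1 ≤ a × a < n) ws × (∀ (i : Fin n) → evalWord ws i ≡ suc (val w i))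

IsReduced : {n : ℕ} → Permutation′ n → List ℕ → Set
IsReduced w ws = IsExpression w ws × (∀ vs → IsExpression w vs → length ws ≤ length vs)

countLetter : ℕ → List ℕ → ℕ
countLetter k []       = 0
countLetter k (a ∷ as) = (if a ≡ᵇ k then 1 else 0) + countLetter k as

private
  anyFin : (n : ℕ) → (Fin n → Bool) → Bool
  anyFin n p = any p (allFin n)

  lt : ℕ → ℕ → Bool
  lt = _<ᵇ_

-- (i₁,i₃) a position pair at k coming from a 321 occurrence:
-- i₁ < i₂ < i₃, w(i₁) > w(i₂) > w(i₃), 1-based i₁ ≤ k < 1-based i₃
posPair321 : {n : ℕ} → ℕ → Permutation′ n → Fin n → Fin n → Bool
posPair321 {n} k w i₁ i₃ =
  lt (toℕ i₁) k ∧ (k ≤ᵇ toℕ i₃) ∧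
  anyFin n (λ i₂ → lt (toℕ i₁) (toℕ i₂) ∧ lt (toℕ i₂) (toℕ i₃) ∧
                   lt (val w i₂) (val w i₁) ∧ lt (val w i₃) (val w i₂))

-- (i₂,i₃) a position pair at k coming from a 3412 occurrence:
-- i₁ < i₂ ≤ k < i₃ < i₄ (1-based), w(i₃) < w(i₄) < w(i₁) < w(i₂)
posPair3412 : {n : ℕ} → ℕ → Permutation′ n → Fin n → Fin n → Bool
posPair3412 {n} k w i₂ i₃ =
  lt (toℕ i₂) k ∧ (k ≤ᵇ toℕ i₃) ∧
  anyFin n (λ i₁ → anyFin n (λ i₄ →
    lt (toℕ i₁) (toℕ i₂) ∧ lt (toℕ i₃) (toℕ i₄) ∧
    lt (val w i₃) (val w i₄) ∧ lt (val w i₄) (val w i₁) ∧ lt (val w i₁) (val w i₂)))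

isPosPair : {n : ℕ} → ℕ → Permutation′ n → Fin n → Fin n → Bool
isPosPair k w a b = posPair321 k w a b ∨ posPair3412 k w a b

-- (j₃,j₁) a value pair at k from a 321 occurrence with values j₁ < j₂ < j₃
-- (j₃ = w(i₁), j₂ = w(i₂), j₁ = w(i₃)), 1-based j₁ ≤ k < 1-based j₃.
-- Values are encoded by the positions carrying them: (p, q) stands for the
-- value pair (w(p), w(q)); as w is a bijection this is a bijective encoding.
valPair321 : {n : ℕ} → ℕ → Permutation′ n → Fin n → Fin n → Bool
valPair321 {n} k w p q =
  lt (val w q) k ∧ (k ≤ᵇ val w p) ∧
  anyFin n (λ i₂ → lt (toℕ p) (toℕ i₂) ∧ lt (toℕ i₂) (toℕ q) ∧
                   lt (val w i₂) (val w p) ∧ lt (val w q) (val w i₂))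

-- (j₄,j₁) a value pair at k from a 3412 occurrence with values
-- j₁ < j₂ ≤ k < j₃ < j₄, where j₄ = w(i₂), j₃ = w(i₁), j₂ = w(i₄), j₁ = w(i₃)
valPair3412 : {n : ℕ} → ℕ → Permutation′ n → Fin n → Fin n → Bool
valPair3412 {n} k w i₂ i₃ =
  anyFin n (λ i₁ → anyFin n (λ i₄ →
    lt (toℕ i₁) (toℕ i₂) ∧ lt (toℕ i₂) (toℕ i₃) ∧ lt (toℕ i₃) (toℕ i₄) ∧
    lt (val w i₃) (val w i₄) ∧ lt (val w i₄) k ∧ (k ≤ᵇ val w i₁) ∧
    lt (val w i₁) (val w i₂)))

isValPair : {n : ℕ} → ℕ → Permutation′ n → Fin n → Fin n → Bool
isValPair k w a b = valPair321 k w a b ∨ valPair3412 k w a b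

allPairs : (n : ℕ) → List (Fin n × Fin n)
allPairs n = cartesianProduct (allFin n) (allFin n)

countPairs : {n : ℕ} → (Fin n → Fin n → Bool) → ℕ
countPairs {n} P = length (filter (λ { (a , b) → T? (P a b) }) (allPairs n))
  where
    open import Relation.Nullary using (Dec; yes; no)
    T? : (b : Bool) → Dec (T b)
    T? true  = yes _
    T? false = no (λ ())

PosPair : {n : ℕ} → ℕ → Permutation′ n → ℕ
PosPair k w = countPairs (isPosPair k w)

ValPair : {n : ℕ} → ℕ → Permutation′ n → ℕ
ValPair k w = countPairs (isValPair k w)

-- Read a word a₁ ⋯ a_m as building the one-line sequence σ_{a₁} ∘ ⋯ ∘ σ_{a_m} of
-- 1-based values from the right.  Call (x, y) a pattern pair of a sequence G at k
-- if x ≺ y, G x > k ≥ G y and x, y are the outer entries of a 321 or of a 3412; the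
-- potential of G is the number of pattern pairs, plus one if some pair crosses the
-- wall at all.  In a reduced word each letter σ_a adds an inversion, so it acts at
-- positions p ≺ q carrying a, a+1.  For a ≠ k every pattern pair survives; for a = k
-- the transposition of p and q moves pattern pairs injectively and the potential
-- strictly grows.  So #σ_k ≤ potential(w) ≤ #pattern pairs(w) + 1.  Pattern pairs of
-- w inject into value pairs of w (choosing the inner entries of a 3412
-- canonically), and pattern pairs of w⁻¹ are position pairs of w; as the reversed
-- word is reduced for w⁻¹, both bounds follow.

module Submission where

open import Defs
open import Data.Nat using (ℕ; zero; suc; _+_; _∸_; _≤_; _<_; _⊓_; _≟_; _<?_; _≤?_; _≡ᵇ_; _<ᵇ_; _≤ᵇ_; z≤n; s≤s)
open import Data.Nat.Properties
open import Data.Bool using (Bool; true; false; T; if_then_else_; _∧_; _∨_)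
open import Data.Bool.Properties using (T-∧; T-∨)
open import Data.Bool.ListAction using (any)
open import Data.Fin using (Fin; toℕ; fromℕ<) renaming (zero to fzero; suc to fsuc; _<_ to _≺_)
open import Data.Fin.Properties using (any?) renaming (_<?_ to _≺?_; _≟_ to _≟ᶠ_)
import Data.Fin.Properties as Fin
open import Data.Fin.Permutation using (Permutation′; _⟨$⟩ʳ_; _⟨$⟩ˡ_; inverseʳ; inverseˡ; flip; _∘ₚ_)
import Data.Fin.Permutation as Perm
open import Data.Fin.Permutation.Components using (transpose)
open import Data.List using (List; []; _∷_; length; _++_; reverse; filter; lookup; allFin)
open import Data.List.Properties using (unfold-reverse; length-++; length-reverse)
open import Data.List.Membership.Propositional using (_∈_)
open import Data.List.Membership.Propositional.Properties using (∈-filter⁺; ∈-filter⁻; ∈-lookup; ∈-allFin; ∈-cartesianProduct⁺)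
import Data.List.Membership.Setoid.Properties as SetoidMembership
open import Data.List.Relation.Unary.Any using (here; there; index)
import Data.List.Relation.Unary.Any as Any
open import Data.List.Relation.Unary.Any.Properties using (any⁺; reverse⁻)
open import Data.List.Relation.Unary.All using (All; []; _∷_)
import Data.List.Relation.Unary.All as All
open import Data.List.Relation.Unary.All.Properties using (++⁺)
open import Data.List.Relation.Unary.AllPairs using (_∷_)
open import Data.List.Relation.Unary.Unique.Propositional using (Unique)
import Data.List.Relation.Unary.Unique.Propositional.Properties as Unique
open import Data.List.Extrema.Nat using (argmin; argmax; argmin-all; argmax-all; f[argmin]≤f[xs]; f[xs]≤f[argmax])
open import Data.Product using (_×_; _,_; proj₁; proj₂; Σ)
open import Data.Sum using (_⊎_; inj₁; inj₂)
open import Data.Empty using (⊥-elim)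
open import Function using (_∘_)
open import Function.Bundles using (Equivalence)
open import Function.Definitions using (Injective)
open import Relation.Nullary using (¬_; Dec; yes; no)
open import Relation.Nullary.Decidable using (_×-dec_; _⊎-dec_; isYes; toWitness; fromWitness)
open import Relation.Unary using (Decidable)
open import Relation.Binary.PropositionalEquality
open import Relation.Binary.Definitions using (tri<; tri≈; tri>)

lookup-injective : {A : Set} {xs : List A} → Unique xs → Injective _≡_ _≡_ (lookup xs)
lookup-injective {xs = _ ∷ _}  _           {fzero}  {fzero}  _ = refl
lookup-injective {xs = _ ∷ _}  (x∉ ∷ _)    {fzero}  {fsuc j} e = ⊥-elim (All.lookup x∉ (∈-lookup j) e)
lookup-injective {xs = _ ∷ _}  (x∉ ∷ _)    {fsuc i} {fzero}  e = ⊥-elim (All.lookup x∉ (∈-lookup i) (sym e))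
lookup-injective {xs = _ ∷ _}  (_ ∷ uniq)  {fsuc i} {fsuc j} e = cong fsuc (lookup-injective uniq e)

injection-length : {A B : Set} {xs : List A} {ys : List B} (f : A → B) → Unique xs →
  (∀ {x y} → x ∈ xs → y ∈ xs → f x ≡ f y → x ≡ y) → (∀ {x} → x ∈ xs → f x ∈ ys) →
  length xs ≤ length ys
injection-length {xs = xs} {ys} f uniq inj into = Fin.injective⇒≤ {f = slot} slot-injective
  where
  slot : Fin (length xs) → Fin (length ys)
  slot i = index (into (∈-lookup i))
  slot-injective : Injective _≡_ _≡_ slot
  slot-injective {i} {j} e = lookup-injective uniq
    (inj (∈-lookup i) (∈-lookup j) (SetoidMembership.index-injective (setoid _) (into (∈-lookup i)) (into (∈-lookup j)) e))

Pair : ℕ → Set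
Pair n = Fin n × Fin n

Holds : {n : ℕ} → (Fin n → Fin n → Bool) → Pair n → Set
Holds P x = T (P (proj₁ x) (proj₂ x))

allPairs-unique : (n : ℕ) → Unique (allPairs n)
allPairs-unique n = Unique.cartesianProduct⁺ (Unique.allFin⁺ n) (Unique.allFin⁺ n)

allPairs-complete : {n : ℕ} (x : Pair n) → x ∈ allPairs n
allPairs-complete (i , j) = ∈-cartesianProduct⁺ (∈-allFin i) (∈-allFin j)

module _ {n : ℕ} {R : Fin n → Fin n → Bool} (R? : Decidable (Holds R)) where

  counted⁻ : ∀ {x} → x ∈ filter R? (allPairs n) → Holds R x
  counted⁻ mx = proj₂ (∈-filter⁻ R? {xs = allPairs n} mx)

  counted⁺ : ∀ {x} → Holds R x → x ∈ filter R? (allPairs n)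
  counted⁺ Rx = ∈-filter⁺ R? (allPairs-complete _) Rx

  counted-unique : Unique (filter R? (allPairs n))
  counted-unique = Unique.filter⁺ R? (allPairs-unique n)

module _ {n : ℕ} {P Q : Fin n → Fin n → Bool} where

  countPairs-injection : (f : Pair n → Pair n) →
    (∀ x → Holds P x → Holds Q (f x)) → (∀ x y → Holds P x → Holds P y → f x ≡ f y → x ≡ y) →
    countPairs P ≤ countPairs Q
  countPairs-injection f maps inj = bound _ _
    where
    bound : (P? : Decidable (Holds P)) (Q? : Decidable (Holds Q)) →
      length (filter P? (allPairs n)) ≤ length (filter Q? (allPairs n))
    bound P? Q? = injection-length f (counted-unique P?)
      (λ mx my → inj _ _ (counted⁻ P? mx) (counted⁻ P? my))
      (λ mx → counted⁺ Q? (maps _ (counted⁻ P? mx)))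

  countPairs-injection⁺ : (f : Pair n → Pair n) → Injective _≡_ _≡_ f → (∀ x → Holds P x → Holds Q (f x)) →
    (z₀ : Pair n) → ¬ Holds P z₀ → Holds Q (f z₀) → suc (countPairs P) ≤ countPairs Q
  countPairs-injection⁺ f inj maps z₀ z₀∉P z₀↦Q = strict _ _
    where
    strict : (P? : Decidable (Holds P)) (Q? : Decidable (Holds Q)) →
      suc (length (filter P? (allPairs n))) ≤ length (filter Q? (allPairs n))
    strict P? Q? = injection-length f (All.tabulate z₀-fresh ∷ counted-unique P?)
      (λ _ _ → inj) into
      where
      z₀-fresh : ∀ {x} → x ∈ filter P? (allPairs n) → z₀ ≢ x
      z₀-fresh mx refl = z₀∉P (counted⁻ P? mx)
      into : ∀ {x} → x ∈ z₀ ∷ filter P? (allPairs n) → f x ∈ filter Q? (allPairs n)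
      into (here refl) = counted⁺ Q? z₀↦Q
      into (there mx)  = counted⁺ Q? (maps _ (counted⁻ P? mx))

  countPairs-mono : (∀ x → Holds P x → Holds Q x) → countPairs P ≤ countPairs Q
  countPairs-mono P⊆Q = countPairs-injection (λ x → x) P⊆Q (λ _ _ _ _ e → e)

  countPairs-exceptOne : (z₀ : Pair n) → (∀ x → Holds P x → x ≡ z₀ ⊎ Holds Q x) →
    countPairs P ≤ suc (countPairs Q)
  countPairs-exceptOne z₀ P⊆z₀Q = bound _ _
    where
    bound : (P? : Decidable (Holds P)) (Q? : Decidable (Holds Q)) →
      length (filter P? (allPairs n)) ≤ suc (length (filter Q? (allPairs n)))
    bound P? Q? = injection-length {ys = z₀ ∷ filter Q? (allPairs n)} (λ x → x)
      (counted-unique P?) (λ _ _ e → e) into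
      where
      into : ∀ {x} → x ∈ filter P? (allPairs n) → x ∈ z₀ ∷ filter Q? (allPairs n)
      into {x} mx with P⊆z₀Q x (counted⁻ P? mx)
      ... | inj₁ x≡z₀ = here x≡z₀
      ... | inj₂ Qx   = there (counted⁺ Q? Qx)

module _ {n : ℕ} {P : Fin n → Fin n → Bool} where

  countPairs-none : (∀ x → ¬ Holds P x) → countPairs P ≡ 0
  countPairs-none none = n≤0⇒n≡0 (bound _)
    where
    bound : (P? : Decidable (Holds P)) → length (filter P? (allPairs n)) ≤ 0
    bound P? = injection-length {ys = []} (λ x → x) (counted-unique P?) (λ _ _ e → e)
      (λ mx → ⊥-elim (none _ (counted⁻ P? mx)))

decide : {n : ℕ} {R : Fin n → Fin n → Set} → (∀ i j → Dec (R i j)) → Fin n → Fin n → Bool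
decide R? i j = isYes (R? i j)

module _ {n : ℕ} {R : Fin n → Fin n → Set} (R? : ∀ i j → Dec (R i j)) where

  decided⁻ : ∀ {i j} → Holds (decide R?) (i , j) → R i j
  decided⁻ {i} {j} h = toWitness {a? = R? i j} h

  decided⁺ : ∀ {i j} → R i j → Holds (decide R?) (i , j)
  decided⁺ {i} {j} r = fromWitness {a? = R? i j} r

data SwapView (a x : ℕ) : Set where
  at-a     : x ≡ a     → swapℕ a x ≡ suc a → SwapView a x
  at-suc-a : x ≡ suc a → swapℕ a x ≡ a     → SwapView a x
  fixed    : x ≢ a → x ≢ suc a → swapℕ a x ≡ x → SwapView a x

private
  if-true : ∀ {b} {y z : ℕ} → b ≡ true → (if b then y else z) ≡ y
  if-true refl = refl

  if-false : ∀ {b} {y z : ℕ} → b ≡ false → (if b then y else z) ≡ z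
  if-false refl = refl

swapView : ∀ a x → SwapView a x
swapView a x with x ≡ᵇ a in x≡ᵇa | x ≡ᵇ suc a in x≡ᵇa+1
... | true  | _     = at-a (≡ᵇ⇒≡ x a (subst T (sym x≡ᵇa) _)) (if-true x≡ᵇa)
... | false | true  = at-suc-a (≡ᵇ⇒≡ x (suc a) (subst T (sym x≡ᵇa+1) _)) (trans (if-false x≡ᵇa) (if-true x≡ᵇa+1))
... | false | false = fixed (λ e → subst T x≡ᵇa (≡⇒≡ᵇ x a e)) (λ e → subst T x≡ᵇa+1 (≡⇒≡ᵇ x (suc a) e))
                            (trans (if-false x≡ᵇa) (if-false x≡ᵇa+1))

swap-a : ∀ a → swapℕ a a ≡ suc a
swap-a a with swapView a a
... | at-a _ e       = e
... | at-suc-a () _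
... | fixed a≢a _ _  = ⊥-elim (a≢a refl)

swap-suc-a : ∀ a → swapℕ a (suc a) ≡ a
swap-suc-a a with swapView a (suc a)
... | at-a () _
... | at-suc-a _ e       = e
... | fixed _ a+1≢a+1 _  = ⊥-elim (a+1≢a+1 refl)

swap-fixed : ∀ a {x} → x ≢ a → x ≢ suc a → swapℕ a x ≡ x
swap-fixed a {x} x≢a x≢a+1 with swapView a x
... | at-a x≡a _     = ⊥-elim (x≢a x≡a)
... | at-suc-a x≡a+1 _ = ⊥-elim (x≢a+1 x≡a+1)
... | fixed _ _ e    = e

swap-involutive : ∀ a x → swapℕ a (swapℕ a x) ≡ x
swap-involutive a x with swapView a x
... | at-a refl e     = trans (cong (swapℕ a) e) (swap-suc-a a)
... | at-suc-a refl e = trans (cong (swapℕ a) e) (swap-a a)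
... | fixed _ _ e     = trans (cong (swapℕ a) e) e

swap-injective : ∀ a {x y} → swapℕ a x ≡ swapℕ a y → x ≡ y
swap-injective a {x} {y} e =
  trans (sym (swap-involutive a x)) (trans (cong (swapℕ a) e) (swap-involutive a y))

swap-monotone : ∀ a {x y} → x < y → ¬ (x ≡ a × y ≡ suc a) → swapℕ a x < swapℕ a y
swap-monotone a {x} {y} x<y not-aa+1 with swapView a x | swapView a y
... | at-a refl _     | at-a refl _     = ⊥-elim (<-irrefl refl x<y)
... | at-a refl _     | at-suc-a refl _ = ⊥-elim (not-aa+1 (refl , refl))
... | at-a refl e     | fixed _ y≢a+1 f = subst₂ _<_ (sym e) (sym f) (≤∧≢⇒< x<y (≢-sym y≢a+1))
... | at-suc-a refl _ | at-a refl _     = ⊥-elim (<-asym x<y (n<1+n _))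
... | at-suc-a refl _ | at-suc-a refl _ = ⊥-elim (<-irrefl refl x<y)
... | at-suc-a refl e | fixed _ _ f     = subst₂ _<_ (sym e) (sym f) (<-trans (n<1+n _) x<y)
... | fixed _ _ e     | at-a refl f     = subst₂ _<_ (sym e) (sym f) (<-trans x<y (n<1+n _))
... | fixed x≢a _ e   | at-suc-a refl f = subst₂ _<_ (sym e) (sym f) (≤∧≢⇒< (≤-pred x<y) x≢a)
... | fixed _ _ e     | fixed _ _ f     = subst₂ _<_ (sym e) (sym f) x<y

swap-above : ∀ {a k} x → a ≢ k → k < x → k < swapℕ a x
swap-above {a} {k} x a≢k k<x with swapView a x
... | at-a refl e     = subst (k <_) (sym e) (m<n⇒m<1+n k<x)
... | at-suc-a refl e = subst (k <_) (sym e) (≤∧≢⇒< (≤-pred k<x) (≢-sym a≢k))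
... | fixed _ _ e     = subst (k <_) (sym e) k<x

swap-below : ∀ {a k} x → a ≢ k → x ≤ k → swapℕ a x ≤ k
swap-below {a} {k} x a≢k x≤k = ≮⇒≥ λ k<σx →
  <⇒≱ (subst (k <_) (swap-involutive a x) (swap-above (swapℕ a x) a≢k k<σx)) x≤k

act : List ℕ → ℕ → ℕ
act []       x = x
act (a ∷ as) x = swapℕ a (act as x)

evalWord≡act : ∀ {n} ws (i : Fin n) → evalWord ws i ≡ act ws (suc (toℕ i))
evalWord≡act []       i = refl
evalWord≡act (a ∷ as) i = cong (swapℕ a) (evalWord≡act as i)

act-++ : ∀ xs ys x → act (xs ++ ys) x ≡ act xs (act ys x)
act-++ []       ys x = refl
act-++ (a ∷ xs) ys x = cong (swapℕ a) (act-++ xs ys x)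

act-injective : ∀ ws {x y} → act ws x ≡ act ws y → x ≡ y
act-injective []       e = e
act-injective (a ∷ as) e = act-injective as (swap-injective a e)

act-reverse : ∀ ws x → act (reverse ws) (act ws x) ≡ x
act-reverse []       x = refl
act-reverse (a ∷ as) x = begin
  act (reverse (a ∷ as)) (swapℕ a (act as x))   ≡⟨ cong (λ l → act l (swapℕ a (act as x))) (unfold-reverse a as) ⟩
  act (reverse as ++ a ∷ []) (swapℕ a (act as x)) ≡⟨ act-++ (reverse as) (a ∷ []) _ ⟩
  act (reverse as) (swapℕ a (swapℕ a (act as x))) ≡⟨ cong (act (reverse as)) (swap-involutive a _) ⟩
  act (reverse as) (act as x)                   ≡⟨ act-reverse as x ⟩
  x                                             ∎
  where open ≡-Reasoning

hit : ℕ → ℕ → ℕ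
hit k a = if a ≡ᵇ k then 1 else 0

hit-same : ∀ k → hit k k ≡ 1
hit-same zero    = refl
hit-same (suc k) = hit-same k

hit-other : ∀ {k a} → a ≢ k → hit k a ≡ 0
hit-other {k} {a} a≢k with a ≡ᵇ k in a≡ᵇk
... | true  = ⊥-elim (a≢k (≡ᵇ⇒≡ a k (subst T (sym a≡ᵇk) _)))
... | false = refl

countLetter-++ : ∀ k xs ys → countLetter k (xs ++ ys) ≡ countLetter k xs + countLetter k ys
countLetter-++ k []       ys = refl
countLetter-++ k (a ∷ xs) ys =
  trans (cong (hit k a +_) (countLetter-++ k xs ys)) (sym (+-assoc (hit k a) (countLetter k xs) _))

countLetter-reverse : ∀ k ws → countLetter k (reverse ws) ≡ countLetter k ws
countLetter-reverse k []       = refl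
countLetter-reverse k (a ∷ as) = begin
  countLetter k (reverse (a ∷ as))           ≡⟨ cong (countLetter k) (unfold-reverse a as) ⟩
  countLetter k (reverse as ++ a ∷ [])       ≡⟨ countLetter-++ k (reverse as) (a ∷ []) ⟩
  countLetter k (reverse as) + (hit k a + 0) ≡⟨ cong₂ _+_ (countLetter-reverse k as) (+-identityʳ (hit k a)) ⟩
  countLetter k as + hit k a                 ≡⟨ +-comm (countLetter k as) (hit k a) ⟩
  countLetter k (a ∷ as)                     ∎
  where open ≡-Reasoning

module _ {n : ℕ} where

  IsInversion : (Fin n → ℕ) → Fin n → Fin n → Set
  IsInversion F i j = i ≺ j × F j < F i

  inversion? : ∀ F i j → Dec (IsInversion F i j)
  inversion? F i j = (i ≺? j) ×-dec (F j <? F i)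

  inversions : (Fin n → ℕ) → ℕ
  inversions F = countPairs (decide (inversion? F))

  Ascent : (Fin n → ℕ) → ℕ → Set
  Ascent G a = Σ (Fin n) λ p → Σ (Fin n) λ q → p ≺ q × G p ≡ a × G q ≡ suc a

  ascent? : ∀ G a → Dec (Ascent G a)
  ascent? G a = any? λ p → any? λ q → (p ≺? q) ×-dec (G p ≟ a) ×-dec (G q ≟ suc a)

  inversions-cong : {F G : Fin n → ℕ} → (∀ i → F i ≡ G i) → inversions F ≤ inversions G
  inversions-cong {F} {G} F≗G = countPairs-mono same
    where
    same : ∀ x → Holds (decide (inversion? F)) x → Holds (decide (inversion? G)) x
    same (i , j) inv with decided⁻ (inversion? F) inv
    ... | i≺j , Fj<Fi = decided⁺ (inversion? G) (i≺j , subst₂ _<_ (F≗G j) (F≗G i) Fj<Fi)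

  module _ (G : Fin n → ℕ) (G-injective : Injective _≡_ _≡_ G) (a : ℕ) where

    swap-inversion : ∀ i j → IsInversion (swapℕ a ∘ G) i j →
      IsInversion G i j ⊎ (G i ≡ a × G j ≡ suc a)
    swap-inversion i j (i≺j , σGj<σGi) with <-cmp (G j) (G i)
    ... | tri< Gj<Gi _ _ = inj₁ (i≺j , Gj<Gi)
    ... | tri≈ _ Gj≡Gi _ = ⊥-elim (<-irrefl (cong toℕ (G-injective (sym Gj≡Gi))) i≺j)
    ... | tri> _ _ Gi<Gj with G i ≟ a | G j ≟ suc a
    ...   | yes Gi≡a | yes Gj≡a+1 = inj₂ (Gi≡a , Gj≡a+1)
    ...   | no Gi≢a  | _          = ⊥-elim (<-asym σGj<σGi (swap-monotone a Gi<Gj (Gi≢a ∘ proj₁)))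
    ...   | yes _    | no Gj≢a+1  = ⊥-elim (<-asym σGj<σGi (swap-monotone a Gi<Gj (Gj≢a+1 ∘ proj₂)))

    inversions-swap : inversions (swapℕ a ∘ G) ≤ inversions G
                    ⊎ (Ascent G a × inversions (swapℕ a ∘ G) ≤ suc (inversions G))
    inversions-swap with ascent? G a
    ... | yes asc@(p , q , _ , Gp≡a , Gq≡a+1) = inj₂ (asc , countPairs-exceptOne (p , q) at-most-new)
      where
      at-most-new : ∀ x → Holds (decide (inversion? (swapℕ a ∘ G))) x →
        x ≡ (p , q) ⊎ Holds (decide (inversion? G)) x
      at-most-new (i , j) inv with swap-inversion i j (decided⁻ (inversion? _) inv)
      ... | inj₁ invG             = inj₂ (decided⁺ (inversion? G) invG)
      ... | inj₂ (Gi≡a , Gj≡a+1) =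
        inj₁ (cong₂ _,_ (G-injective (trans Gi≡a (sym Gp≡a))) (G-injective (trans Gj≡a+1 (sym Gq≡a+1))))
    ... | no no-ascent = inj₁ (countPairs-mono no-new)
      where
      no-new : ∀ x → Holds (decide (inversion? (swapℕ a ∘ G))) x → Holds (decide (inversion? G)) x
      no-new (i , j) inv with swap-inversion i j (decided⁻ (inversion? _) inv)
      ... | inj₁ invG             = decided⁺ (inversion? G) invG
      ... | inj₂ (Gi≡a , Gj≡a+1) = ⊥-elim (no-ascent (i , j , proj₁ (decided⁻ (inversion? _) inv) , Gi≡a , Gj≡a+1))

    inversions-swap≤ : inversions (swapℕ a ∘ G) ≤ suc (inversions G)
    inversions-swap≤ with inversions-swap
    ... | inj₁ ≤inv       = m≤n⇒m≤1+n ≤inv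
    ... | inj₂ (_ , ≤inv) = ≤inv

    inversions-swap-ascent : inversions (swapℕ a ∘ G) ≡ suc (inversions G) → Ascent G a
    inversions-swap-ascent grows with inversions-swap
    ... | inj₁ ≤inv     = ⊥-elim (1+n≰n (subst (_≤ inversions G) grows ≤inv))
    ... | inj₂ (asc , _) = asc

oneLine : {n : ℕ} → List ℕ → Fin n → ℕ
oneLine ws i = act ws (suc (toℕ i))

oneLine-injective : {n : ℕ} (ws : List ℕ) → Injective _≡_ _≡_ (oneLine {n} ws)
oneLine-injective ws e = Fin.toℕ-injective (suc-injective (act-injective ws e))

inversions≤length : {n : ℕ} (ws : List ℕ) → inversions (oneLine {n} ws) ≤ length ws
inversions≤length {n} [] = ≤-reflexive (countPairs-none increasing)
  where
  increasing : ∀ x → ¬ Holds (decide (inversion? (oneLine {n} []))) x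
  increasing (i , j) inv with decided⁻ (inversion? _) inv
  ... | i≺j , j>i = <-asym i≺j (≤-pred j>i)
inversions≤length {n} (a ∷ as) =
  ≤-trans (inversions-swap≤ (oneLine {n} as) (oneLine-injective as) a) (s≤s (inversions≤length {n} as))

transpose-left : ∀ {n} (p q : Fin n) → transpose p q p ≡ q
transpose-left p q with p ≟ᶠ p
... | yes _   = refl
... | no p≢p  = ⊥-elim (p≢p refl)

transpose-right : ∀ {n} (p q : Fin n) → transpose p q q ≡ p
transpose-right p q with q ≟ᶠ p
... | yes q≡p = q≡p
... | no _ with q ≟ᶠ q
...   | yes _  = refl
...   | no q≢q = ⊥-elim (q≢q refl)

transpose-other : ∀ {n} {p q i : Fin n} → i ≢ p → i ≢ q → transpose p q i ≡ i
transpose-other {p = p} {q} {i} i≢p i≢q with i ≟ᶠ p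
... | yes i≡p = ⊥-elim (i≢p i≡p)
... | no _ with i ≟ᶠ q
...   | yes i≡q = ⊥-elim (i≢q i≡q)
...   | no _    = refl

data TransposeView {n : ℕ} (p q i : Fin n) : Set where
  at-p      : i ≡ p → transpose p q i ≡ q → TransposeView p q i
  at-q      : i ≡ q → transpose p q i ≡ p → TransposeView p q i
  elsewhere : i ≢ p → i ≢ q → transpose p q i ≡ i → TransposeView p q i

transposeView : ∀ {n} (p q i : Fin n) → TransposeView p q i
transposeView p q i with i ≟ᶠ p
... | yes refl = at-p refl (transpose-left p q)
... | no i≢p with i ≟ᶠ q
...   | yes refl = at-q refl (transpose-right p q)
...   | no i≢q   = elsewhere i≢p i≢q (transpose-other i≢p i≢q)

transpose-involutive : ∀ {n} (p q i : Fin n) → transpose p q (transpose p q i) ≡ i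
transpose-involutive p q i with transposeView p q i
... | at-p refl e      = trans (cong (transpose p q) e) (transpose-right p q)
... | at-q refl e      = trans (cong (transpose p q) e) (transpose-left p q)
... | elsewhere _ _ e  = trans (cong (transpose p q) e) e

transposePair : ∀ {n} (p q : Fin n) → Pair n → Pair n
transposePair p q (i , j) = transpose p q i , transpose p q j

transposePair-involutive : ∀ {n} (p q : Fin n) x → transposePair p q (transposePair p q x) ≡ x
transposePair-involutive p q (i , j) = cong₂ _,_ (transpose-involutive p q i) (transpose-involutive p q j)

transposePair-injective : ∀ {n} (p q : Fin n) → Injective _≡_ _≡_ (transposePair p q)
transposePair-injective p q {x} {y} e =
  trans (sym (transposePair-involutive p q x)) (trans (cong (transposePair p q) e) (transposePair-involutive p q y))

module _ {n : ℕ} {p q : Fin n} (adjacent : toℕ q ≡ suc (toℕ p)) where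

  private
    τ : Fin n → Fin n
    τ = transpose p q

  transpose-adjacent : ∀ i → swapℕ (suc (toℕ p)) (suc (toℕ i)) ≡ suc (toℕ (τ i))
  transpose-adjacent i with transposeView p q i
  ... | at-p refl e = trans (swap-a (suc (toℕ p))) (cong suc (trans (sym adjacent) (cong toℕ (sym e))))
  ... | at-q refl e = trans (cong (swapℕ (suc (toℕ p))) (cong suc adjacent)) (trans (swap-suc-a (suc (toℕ p))) (cong (suc ∘ toℕ) (sym e)))
  ... | elsewhere i≢p i≢q e = trans (swap-fixed _ (λ e′ → i≢p (Fin.toℕ-injective (suc-injective e′)))
                                     (λ e′ → i≢q (Fin.toℕ-injective (trans (suc-injective e′) (sym adjacent)))))
                                  (cong (suc ∘ toℕ) (sym e))

  transpose-adjacent-monotone : ∀ {i j} → i ≺ j → ¬ (i ≡ p × j ≡ q) → τ i ≺ τ j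
  transpose-adjacent-monotone {i} {j} i≺j not-pq = ≤-pred (subst₂ _<_ (transpose-adjacent i) (transpose-adjacent j)
    (swap-monotone _ (s≤s i≺j) λ (i+1≡p+1 , j+1≡p+2) →
      not-pq (Fin.toℕ-injective (suc-injective i+1≡p+1) , Fin.toℕ-injective (trans (suc-injective j+1≡p+2) (sym adjacent)))))

  inversions-transpose : (F : Fin n → ℕ) → F q < F p → suc (inversions (F ∘ τ)) ≤ inversions F
  inversions-transpose F descent =
    countPairs-injection⁺ (transposePair p q) (transposePair-injective p q) moved (q , p) q≻p pq-inversion
    where
    p≺q : p ≺ q
    p≺q = subst (toℕ p <_) (sym adjacent) (n<1+n (toℕ p))
    moved : ∀ x → Holds (decide (inversion? (F ∘ τ))) x → Holds (decide (inversion? F)) (transposePair p q x)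
    moved (i , j) inv with decided⁻ (inversion? (F ∘ τ)) inv
    ... | i≺j , Fτj<Fτi = decided⁺ (inversion? F) (transpose-adjacent-monotone i≺j not-pq , Fτj<Fτi)
      where
      not-pq : ¬ (i ≡ p × j ≡ q)
      not-pq (refl , refl) = <-asym descent
        (subst₂ _<_ (cong F (transpose-right p q)) (cong F (transpose-left p q)) Fτj<Fτi)
    q≻p : ¬ Holds (decide (inversion? (F ∘ τ))) (q , p)
    q≻p inv = <-asym p≺q (proj₁ (decided⁻ (inversion? (F ∘ τ)) inv))
    pq-inversion : Holds (decide (inversion? F)) (transposePair p q (q , p))
    pq-inversion = decided⁺ (inversion? F)
      (subst₂ _≺_ (sym (transpose-right p q)) (sym (transpose-left p q)) p≺q ,
       subst₂ _<_ (cong F (sym (transpose-left p q))) (cong F (sym (transpose-right p q))) descent)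

module _ {n : ℕ} where

  AdjacentDescent : (Fin n → ℕ) → Set
  AdjacentDescent F = Σ (Fin n) λ p → Σ (Fin n) λ q → toℕ q ≡ suc (toℕ p) × F q < F p

  adjacentDescent? : ∀ F → Dec (AdjacentDescent F)
  adjacentDescent? F = any? λ p → any? λ q → (toℕ q ≟ suc (toℕ p)) ×-dec (F q <? F p)

  increasing : (F : Fin n → ℕ) → Injective _≡_ _≡_ F → ¬ AdjacentDescent F → ∀ {i j} → i ≺ j → F i < F j
  increasing F F-injective no-descent {i} {j} i≺j =
    rise (toℕ j ∸ suc (toℕ i)) i j (sym (m+[n∸m]≡n i≺j))
    where
    step : ∀ i j → toℕ j ≡ suc (toℕ i) → F i < F j
    step i j adjacent with <-cmp (F i) (F j)
    ... | tri< Fi<Fj _ _ = Fi<Fj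
    ... | tri≈ _ Fi≡Fj _ = ⊥-elim (1+n≢n (trans (sym adjacent) (cong toℕ (sym (F-injective Fi≡Fj)))))
    ... | tri> _ _ Fj<Fi = ⊥-elim (no-descent (i , j , adjacent , Fj<Fi))
    rise : ∀ d i j → toℕ j ≡ suc (toℕ i) + d → F i < F j
    rise zero    i j gap = step i j (trans gap (cong suc (+-identityʳ (toℕ i))))
    rise (suc d) i j gap = <-trans (step i m (Fin.toℕ-fromℕ< m<n)) (rise d m j gap′)
      where
      m<n : suc (toℕ i) < n
      m<n = ≤-<-trans (m≤m+n (suc (toℕ i)) (suc d)) (subst (_< n) gap (Fin.toℕ<n j))
      m : Fin n
      m = fromℕ< m<n
      gap′ : toℕ j ≡ suc (toℕ m) + d
      gap′ = begin
        toℕ j                  ≡⟨ gap ⟩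
        suc (toℕ i) + suc d    ≡⟨ +-suc (suc (toℕ i)) d ⟩
        suc (suc (toℕ i)) + d  ≡⟨ cong (λ l → suc l + d) (sym (Fin.toℕ-fromℕ< m<n)) ⟩
        suc (toℕ m) + d        ∎
        where open ≡-Reasoning

  permutation-injective : (π : Permutation′ n) → Injective _≡_ _≡_ (π ⟨$⟩ʳ_)
  permutation-injective π {i} {j} e = trans (sym (inverseˡ π)) (trans (cong (π ⟨$⟩ˡ_) e) (inverseˡ π))

  inverse-injective : (π : Permutation′ n) → Injective _≡_ _≡_ (π ⟨$⟩ˡ_)
  inverse-injective π {i} {j} e = trans (sym (inverseʳ π)) (trans (cong (π ⟨$⟩ʳ_) e) (inverseʳ π))

  increasing-dominates : (f : Fin n → Fin n) → (∀ {i j} → i ≺ j → f i ≺ f j) → ∀ i → toℕ i ≤ toℕ (f i)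
  increasing-dominates f f-increasing i =
    subst (λ i′ → toℕ i ≤ toℕ (f i′)) (Fin.fromℕ<-toℕ i (Fin.toℕ<n i)) (below (toℕ i) (Fin.toℕ<n i))
    where
    below : ∀ m (m<n : m < n) → m ≤ toℕ (f (fromℕ< m<n))
    below zero    _   = z≤n
    below (suc m) m<n = ≤-<-trans (below m (<-trans (n<1+n m) m<n))
      (f-increasing (subst₂ _<_ (sym (Fin.toℕ-fromℕ< _)) (sym (Fin.toℕ-fromℕ< m<n)) (n<1+n m)))

  -- An increasing permutation is the identity (apply the above to π and π⁻¹).
  increasing-identity : (π : Permutation′ n) → (∀ {i j} → i ≺ j → π ⟨$⟩ʳ i ≺ π ⟨$⟩ʳ j) →
    ∀ i → toℕ (π ⟨$⟩ʳ i) ≡ toℕ i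
  increasing-identity π π-increasing i = ≤-antisym
    (subst (λ i′ → toℕ (π ⟨$⟩ʳ i) ≤ toℕ i′) (inverseˡ π) (increasing-dominates (π ⟨$⟩ˡ_) inverse-increasing (π ⟨$⟩ʳ i)))
    (increasing-dominates (π ⟨$⟩ʳ_) π-increasing i)
    where
    inverse-increasing : ∀ {i j} → i ≺ j → π ⟨$⟩ˡ i ≺ π ⟨$⟩ˡ j
    inverse-increasing {i} {j} i≺j with <-cmp (toℕ (π ⟨$⟩ˡ i)) (toℕ (π ⟨$⟩ˡ j))
    ... | tri< lt _ _ = lt
    ... | tri≈ _ e _  = ⊥-elim (<-irrefl (cong toℕ (inverse-injective π (Fin.toℕ-injective e))) i≺j)
    ... | tri> _ _ gt = ⊥-elim (<-asym i≺j (subst₂ _≺_ (inverseʳ π) (inverseʳ π) (π-increasing gt)))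

values : {n : ℕ} → Permutation′ n → Fin n → ℕ
values π i = suc (toℕ (π ⟨$⟩ʳ i))

values-injective : {n : ℕ} (π : Permutation′ n) → Injective _≡_ _≡_ (values π)
values-injective π e = permutation-injective π (Fin.toℕ-injective (suc-injective e))

ValidLetters : ℕ → List ℕ → Set
ValidLetters n = All (λ a → 1 ≤ a × a < n)

Represents : {n : ℕ} → List ℕ → Permutation′ n → Set
Represents {n} vs π = ValidLetters n vs × (∀ i → oneLine vs i ≡ values π i)

-- Bubble sort: every π is a product of at most inversions(π) simple reflections.
sortingWord : {n : ℕ} (π : Permutation′ n) → Σ (List ℕ) λ vs → Represents vs π × length vs ≤ inversions (values π)
sortingWord π = sort _ π ≤-refl
  where
  sort : ∀ {n} fuel (π : Permutation′ n) → inversions (values π) ≤ fuel →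
    Σ (List ℕ) λ vs → Represents vs π × length vs ≤ inversions (values π)
  sort fuel π _ with adjacentDescent? (values π)
  sort fuel π _ | no no-descent = [] , ([] , sorted) , z≤n
    where
    sorted : ∀ i → oneLine [] i ≡ values π i
    sorted i = cong suc (sym (increasing-identity π
      (λ i≺j → ≤-pred (increasing (values π) (values-injective π) no-descent i≺j)) i))
  sort zero π bounded | yes (p , q , adjacent , descent) =
    ⊥-elim (1+n≰n (≤-trans (inversions-transpose adjacent (values π) descent) (≤-trans bounded z≤n)))
  sort {n} (suc fuel) π bounded | yes (p , q , adjacent , descent)
    with sort fuel (Perm.transpose p q ∘ₚ π) (≤-pred (≤-trans (inversions-transpose adjacent (values π) descent) bounded))
  ... | vs , (valid , represents) , short =
    vs ++ b ∷ [] , (++⁺ valid ((s≤s z≤n , subst (_< n) adjacent (Fin.toℕ<n q)) ∷ []) , represents′) ,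
    subst (_≤ inversions (values π)) (sym (trans (length-++ vs) (+-comm (length vs) 1)))
      (≤-trans (s≤s short) (inversions-transpose adjacent (values π) descent))
    where
    b : ℕ
    b = suc (toℕ p)
    represents′ : ∀ i → oneLine (vs ++ b ∷ []) i ≡ values π i
    represents′ i = begin
      act (vs ++ b ∷ []) (suc (toℕ i))   ≡⟨ act-++ vs (b ∷ []) _ ⟩
      act vs (swapℕ b (suc (toℕ i)))     ≡⟨ cong (act vs) (transpose-adjacent adjacent i) ⟩
      oneLine vs (transpose p q i)       ≡⟨ represents (transpose p q i) ⟩
      values π (transpose p q (transpose p q i)) ≡⟨ cong (values π) (transpose-involutive p q i) ⟩
      values π i                         ∎
      where open ≡-Reasoning

module _ {n : ℕ} where

  expression-oneLine : {w : Permutation′ n} {ws : List ℕ} → IsExpression w ws → ∀ i → oneLine ws i ≡ values w i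
  expression-oneLine {ws = ws} (_ , evaluates) i = trans (sym (evalWord≡act ws i)) (evaluates i)

  -- A reduced word has exactly as many letters as w has inversions: bubble
  -- sort gives a word of that length, and no word is shorter.
  reduced-length : {w : Permutation′ n} {ws : List ℕ} → IsReduced w ws → length ws ≡ inversions (oneLine {n} ws)
  reduced-length {w} {ws} (expression , minimal) with sortingWord w
  ... | vs , (valid , represents) , short = ≤-antisym
    (≤-trans (minimal vs (valid , λ i → trans (evalWord≡act vs i) (represents i)))
      (≤-trans short (inversions-cong {n} {values w} {oneLine ws} (λ i → sym (expression-oneLine {w = w} {ws = ws} expression i)))))
    (inversions≤length {n} ws)

  expression-reverse : {w : Permutation′ n} {ws : List ℕ} → IsExpression w ws → IsExpression (flip w) (reverse ws)
  expression-reverse {w} {ws} (valid , evaluates) =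
    All.tabulate (λ m → All.lookup valid (reverse⁻ m)) , reverse-evaluates
    where
    reverse-evaluates : ∀ i → evalWord (reverse ws) i ≡ suc (toℕ (w ⟨$⟩ˡ i))
    reverse-evaluates i = begin
      evalWord (reverse ws) i
        ≡⟨ evalWord≡act (reverse ws) i ⟩
      act (reverse ws) (suc (toℕ i))
        ≡⟨ cong (λ j → act (reverse ws) (suc (toℕ j))) (sym (inverseʳ w)) ⟩
      act (reverse ws) (suc (toℕ (w ⟨$⟩ʳ (w ⟨$⟩ˡ i))))
        ≡⟨ cong (act (reverse ws)) (sym (expression-oneLine {w = w} {ws = ws} (valid , evaluates) (w ⟨$⟩ˡ i))) ⟩
      act (reverse ws) (act ws (suc (toℕ (w ⟨$⟩ˡ i))))
        ≡⟨ act-reverse ws _ ⟩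
      suc (toℕ (w ⟨$⟩ˡ i))
        ∎
      where open ≡-Reasoning

  reduced-reverse : {w : Permutation′ n} {ws : List ℕ} → IsReduced w ws → IsReduced (flip w) (reverse ws)
  reduced-reverse {w} {ws} (expression , minimal) = expression-reverse {w = w} {ws = ws} expression , λ vs vs-expression →
    subst (_≤ length vs) (sym (length-reverse ws))
      (subst (length ws ≤_) (length-reverse vs) (minimal (reverse vs) (expression-reverse {w = flip w} {ws = vs} vs-expression)))

module _ {n : ℕ} {P : Fin n → Set} (P? : Decidable P) (f : Fin n → ℕ) where

  private
    candidates : List (Fin n)
    candidates = filter P? (allFin n)

    all-candidates : All P candidates
    all-candidates = All.tabulate λ m → proj₂ (∈-filter⁻ P? {xs = allFin n} m)

    candidate : ∀ {z} → P z → z ∈ candidates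
    candidate Pz = ∈-filter⁺ P? (∈-allFin _) Pz

  minimiser : ∀ {i} → P i → Σ (Fin n) λ j → P j × (∀ z → P z → f j ≤ f z)
  minimiser {i} Pi = argmin f i candidates , argmin-all f Pi all-candidates ,
    λ z Pz → All.lookup (f[argmin]≤f[xs] i candidates) (candidate Pz)

  maximiser : ∀ {i} → P i → Σ (Fin n) λ j → P j × (∀ z → P z → f z ≤ f j)
  maximiser {i} Pi = argmax f i candidates , argmax-all f Pi all-candidates ,
    λ z Pz → All.lookup (f[xs]≤f[argmax] i candidates) (candidate Pz)

module _ {n : ℕ} (k : ℕ) (G : Fin n → ℕ) where

  Pattern321 : Fin n → Fin n → Set
  Pattern321 x y = k < G x × G y ≤ k ×
    Σ (Fin n) λ m → x ≺ m × m ≺ y × G y < G m × G m < G x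

  Pattern3412 : Fin n → Fin n → Set
  Pattern3412 x y = k < G x × G y ≤ k ×
    Σ (Fin n) λ u → Σ (Fin n) λ v → x ≺ u × u ≺ v × v ≺ y × G x < G u × G v < G y

  WallPair : Fin n → Fin n → Set
  WallPair x y = Pattern321 x y ⊎ Pattern3412 x y

  Crossing : Set
  Crossing = Σ (Fin n) λ x → Σ (Fin n) λ y → x ≺ y × k < G x × G y ≤ k

  pattern321? : ∀ x y → Dec (Pattern321 x y)
  pattern321? x y = (k <? G x) ×-dec (G y ≤? k) ×-dec
    any? (λ m → (x ≺? m) ×-dec (m ≺? y) ×-dec (G y <? G m) ×-dec (G m <? G x))

  pattern3412? : ∀ x y → Dec (Pattern3412 x y)
  pattern3412? x y = (k <? G x) ×-dec (G y ≤? k) ×-dec any? λ u → any? λ v →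
    (x ≺? u) ×-dec (u ≺? v) ×-dec (v ≺? y) ×-dec (G x <? G u) ×-dec (G v <? G y)

  wallPair? : ∀ x y → Dec (WallPair x y)
  wallPair? x y = pattern321? x y ⊎-dec pattern3412? x y

  crossing? : Dec Crossing
  crossing? = any? λ x → any? λ y → (x ≺? y) ×-dec (k <? G x) ×-dec (G y ≤? k)

  wallPairs : ℕ
  wallPairs = countPairs (decide wallPair?)

  crossed : ℕ
  crossed with crossing?
  ... | yes _ = 1
  ... | no _  = 0

  -- The quantity that each letter σ_k of a reduced word increases.
  potential : ℕ
  potential = wallPairs + crossed

  crossed≤1 : crossed ≤ 1
  crossed≤1 with crossing?
  ... | yes _ = ≤-refl
  ... | no _  = z≤n

  crossed-yes : Crossing → crossed ≡ 1
  crossed-yes c with crossing?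
  ... | yes _ = refl
  ... | no ¬c = ⊥-elim (¬c c)

  crossed-no : ¬ Crossing → crossed ≡ 0
  crossed-no ¬c with crossing?
  ... | yes c = ⊥-elim (¬c c)
  ... | no _  = refl

  wallPair-ordered : ∀ {x y} → WallPair x y → x ≺ y
  wallPair-ordered (inj₁ (_ , _ , m , x≺m , m≺y , _))           = <-trans x≺m m≺y
  wallPair-ordered (inj₂ (_ , _ , u , v , x≺u , u≺v , v≺y , _)) = <-trans x≺u (<-trans u≺v v≺y)

wallPair-cong : ∀ {n} k {F G : Fin n → ℕ} → (∀ i → F i ≡ G i) → ∀ {x y} → WallPair k F x y → WallPair k G x y
wallPair-cong k {F} {G} F≗G {x} {y} (inj₁ (kx , yk , m , x≺m , m≺y , ym , mx)) =
  inj₁ (subst (k <_) (F≗G x) kx , subst (_≤ k) (F≗G y) yk , m , x≺m , m≺y ,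
        subst₂ _<_ (F≗G y) (F≗G m) ym , subst₂ _<_ (F≗G m) (F≗G x) mx)
wallPair-cong k {F} {G} F≗G {x} {y} (inj₂ (kx , yk , u , v , x≺u , u≺v , v≺y , xu , vy)) =
  inj₂ (subst (k <_) (F≗G x) kx , subst (_≤ k) (F≗G y) yk , u , v , x≺u , u≺v , v≺y ,
        subst₂ _<_ (F≗G x) (F≗G u) xu , subst₂ _<_ (F≗G v) (F≗G y) vy)

wallPairs-cong : ∀ {n} k {F G : Fin n → ℕ} → (∀ i → F i ≡ G i) → wallPairs k F ≤ wallPairs k G
wallPairs-cong {n} k {F} {G} F≗G = countPairs-mono preserved
  where
  preserved : ∀ x → Holds (decide (wallPair? k F)) x → Holds (decide (wallPair? k G)) x
  preserved (x , y) h = decided⁺ (wallPair? k G) (wallPair-cong k F≗G (decided⁻ (wallPair? k F) h))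

module Letter {n : ℕ} (G : Fin n → ℕ) (G-injective : Injective _≡_ _≡_ G) (a : ℕ)
              {p q : Fin n} (p≺q : p ≺ q) (Gp≡a : G p ≡ a) (Gq≡a+1 : G q ≡ suc a) where

  F : Fin n → ℕ
  F = swapℕ a ∘ G

  F-at-p : F p ≡ suc a
  F-at-p = trans (cong (swapℕ a) Gp≡a) (swap-a a)

  F-at-q : F q ≡ a
  F-at-q = trans (cong (swapℕ a) Gq≡a+1) (swap-suc-a a)

  F-elsewhere : ∀ {i} → i ≢ p → i ≢ q → F i ≡ G i
  F-elsewhere i≢p i≢q = swap-fixed a (λ e → i≢p (G-injective (trans e (sym Gp≡a))))
                                      (λ e → i≢q (G-injective (trans e (sym Gq≡a+1))))

  F-monotone : ∀ {i j} → G i < G j → ¬ (i ≡ p × j ≡ q) → F i < F j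
  F-monotone Gi<Gj not-pq = swap-monotone a Gi<Gj λ (Gi≡a , Gj≡a+1) →
    not-pq (G-injective (trans Gi≡a (sym Gp≡a)) , G-injective (trans Gj≡a+1 (sym Gq≡a+1)))

  q⊀p : ∀ {i j} → i ≡ q → j ≡ p → ¬ i ≺ j
  q⊀p refl refl q≺p = <-asym p≺q q≺p

  module OffWall (k : ℕ) (a≢k : a ≢ k) where

    stays-above : ∀ {x} → k < G x → k < F x
    stays-above {x} = swap-above (G x) a≢k

    stays-below : ∀ {y} → G y ≤ k → F y ≤ k
    stays-below {y} = swap-below (G y) a≢k

    wallPair-survives : ∀ {x y} → WallPair k G x y → WallPair k F x y
    wallPair-survives {x} {y} (inj₁ (kx , yk , m , x≺m , m≺y , ym , mx)) =
      inj₁ (stays-above kx , stays-below yk , m , x≺m , m≺y ,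
            F-monotone ym (λ (y≡p , m≡q) → q⊀p m≡q y≡p m≺y) ,
            F-monotone mx (λ (m≡p , x≡q) → q⊀p x≡q m≡p x≺m))
    wallPair-survives {x} {y} (inj₂ (kx , yk , u , v , x≺u , u≺v , v≺y , xu , vy))
      with (x ≟ᶠ p) ×-dec (u ≟ᶠ q) | (v ≟ᶠ p) ×-dec (y ≟ᶠ q)
    ... | yes (refl , refl) | _ =
      -- σ_a turns the 3 and 4 of the occurrence into a 321 with middle u
      inj₁ (stays-above kx , stays-below yk , u , x≺u , <-trans u≺v v≺y ,
            F-monotone (≤-<-trans yk (<-trans kx xu)) (λ (y≡p , _) → <-irrefl (cong toℕ (sym y≡p)) (<-trans x≺u (<-trans u≺v v≺y))) ,
            subst₂ _<_ (sym F-at-q) (sym F-at-p) (n<1+n a))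
    ... | no _ | yes (refl , refl) =
      -- σ_a turns the 1 and 2 of the occurrence into a 321 with middle v
      inj₁ (stays-above kx , stays-below yk , v , <-trans x≺u u≺v , v≺y ,
            subst₂ _<_ (sym F-at-q) (sym F-at-p) (n<1+n a) ,
            F-monotone (<-≤-trans vy (≤-trans yk (<⇒≤ kx))) (λ (_ , x≡q) → <-irrefl (cong toℕ x≡q) (<-trans x≺u (<-trans u≺v v≺y))))
    ... | no not-xu | no not-vy =
      inj₂ (stays-above kx , stays-below yk , u , v , x≺u , u≺v , v≺y , F-monotone xu not-xu , F-monotone vy not-vy)

    crossing-survives : Crossing k G → Crossing k F
    crossing-survives (x , y , x≺y , kx , yk) = x , y , x≺y , stays-above kx , stays-below yk

-- At the wall (a = k): σ_k moves each pattern pair (x, y) of G to the pattern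
-- pair (τ x, τ y) of F, where τ transposes p and q.
module AtWall {n : ℕ} (G : Fin n → ℕ) (G-injective : Injective _≡_ _≡_ G) (k : ℕ)
              {p q : Fin n} (p≺q : p ≺ q) (Gp≡k : G p ≡ k) (Gq≡k+1 : G q ≡ suc k) where

  open Letter G G-injective k p≺q Gp≡k Gq≡k+1

  τ : Fin n → Fin n
  τ = transpose p q

  F∘τ≗G : ∀ i → F (τ i) ≡ G i
  F∘τ≗G i with transposeView p q i
  ... | at-p refl e         = trans (cong F e) (trans F-at-q (sym Gp≡k))
  ... | at-q refl e         = trans (cong F e) (trans F-at-p (sym Gq≡k+1))
  ... | elsewhere i≢p i≢q e = trans (cong F e) (F-elsewhere i≢p i≢q)

  τ-left : ∀ {x z : Fin n} → x ≢ p → x ≺ z → τ x ≺ z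
  τ-left {x} {z} x≢p x≺z with transposeView p q x
  ... | at-p x≡p _        = ⊥-elim (x≢p x≡p)
  ... | at-q refl e       = subst (_≺ z) (sym e) (<-trans p≺q x≺z)
  ... | elsewhere _ _ e   = subst (_≺ z) (sym e) x≺z

  τ-right : ∀ {y z : Fin n} → y ≢ q → z ≺ y → z ≺ τ y
  τ-right {y} {z} y≢q z≺y with transposeView p q y
  ... | at-p refl e       = subst (z ≺_) (sym e) (<-trans z≺y p≺q)
  ... | at-q y≡q _        = ⊥-elim (y≢q y≡q)
  ... | elsewhere _ _ e   = subst (z ≺_) (sym e) z≺y

  above-≢p : ∀ {x} → k < G x → x ≢ p
  above-≢p kx refl = <-irrefl (sym Gp≡k) kx

  below-≢q : ∀ {y} → G y ≤ k → y ≢ q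
  below-≢q yk refl = 1+n≰n (subst (_≤ k) Gq≡k+1 yk)

  ≺-≢ : ∀ {i j : Fin n} → i ≺ j → i ≢ j
  ≺-≢ i≺j refl = <-irrefl refl i≺j

  -- A 321-middle at p or q remains a middle, now carrying k+1, resp. k; the
  -- inner entries of a 3412 lie away from the wall and stay fixed.
  wallPair-moves : ∀ {x y} → WallPair k G x y → WallPair k F (τ x) (τ y)
  wallPair-moves {x} {y} (inj₁ (kx , yk , m , x≺m , m≺y , ym , mx)) with transposeView p q m
  ... | at-p refl _ =
    inj₁ (above , below , p , τ-left (above-≢p kx) x≺m , τ-right (below-≢q yk) m≺y ,
          subst₂ _<_ (sym (F∘τ≗G y)) (sym F-at-p) (s≤s yk) ,
          subst₂ _<_ (sym F-at-p) (sym (F∘τ≗G x))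
            (≤∧≢⇒< kx λ k+1≡Gx → ≺-≢ (<-trans x≺m p≺q) (G-injective (trans (sym k+1≡Gx) (sym Gq≡k+1)))))
    where
    above = subst (k <_) (sym (F∘τ≗G x)) kx
    below = subst (_≤ k) (sym (F∘τ≗G y)) yk
  ... | at-q refl _ =
    inj₁ (above , below , q , τ-left (above-≢p kx) x≺m , τ-right (below-≢q yk) m≺y ,
          subst₂ _<_ (sym (F∘τ≗G y)) (sym F-at-q)
            (≤∧≢⇒< yk λ Gy≡k → ≺-≢ (<-trans p≺q m≺y) (G-injective (trans Gp≡k (sym Gy≡k)))) ,
          subst₂ _<_ (sym F-at-q) (sym (F∘τ≗G x)) (<-trans (n<1+n k) (subst (_< G x) Gq≡k+1 mx)))
    where
    above = subst (k <_) (sym (F∘τ≗G x)) kx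
    below = subst (_≤ k) (sym (F∘τ≗G y)) yk
  ... | elsewhere m≢p m≢q _ =
    inj₁ (above , below , m , τ-left (above-≢p kx) x≺m , τ-right (below-≢q yk) m≺y ,
          subst₂ _<_ (sym (F∘τ≗G y)) (sym (F-elsewhere m≢p m≢q)) ym ,
          subst₂ _<_ (sym (F-elsewhere m≢p m≢q)) (sym (F∘τ≗G x)) mx)
    where
    above = subst (k <_) (sym (F∘τ≗G x)) kx
    below = subst (_≤ k) (sym (F∘τ≗G y)) yk
  wallPair-moves {x} {y} (inj₂ (kx , yk , u , v , x≺u , u≺v , v≺y , xu , vy)) =
    inj₂ (subst (k <_) (sym (F∘τ≗G x)) kx , subst (_≤ k) (sym (F∘τ≗G y)) yk , u , v ,
          τ-left (above-≢p kx) x≺u , u≺v , τ-right (below-≢q yk) v≺y ,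
          subst₂ _<_ (sym (F∘τ≗G x)) (sym (F-elsewhere u≢p u≢q)) xu ,
          subst₂ _<_ (sym (F-elsewhere v≢p v≢q)) (sym (F∘τ≗G y)) vy)
    where
    u≢p : u ≢ p
    u≢p = above-≢p (<-trans kx xu)
    u≢q : u ≢ q
    u≢q refl = <-irrefl refl (<-≤-trans (subst (G x <_) Gq≡k+1 xu) kx)
    v≢p : v ≢ p
    v≢p refl = <-irrefl refl (<-≤-trans (subst (_< G y) Gp≡k vy) yk)
    v≢q : v ≢ q
    v≢q = below-≢q (≤-trans (<⇒≤ vy) yk)

  crossing-created : Crossing k F
  crossing-created = p , q , p≺q , subst (k <_) (sym F-at-p) (n<1+n k) , subst (_≤ k) (sym F-at-q) ≤-refl

  NewPair : Set
  NewPair = Σ (Fin n) λ x → Σ (Fin n) λ y → WallPair k F x y × ¬ WallPair k G (τ x) (τ y)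

  -- If some i ≺ p has G i > k+1, the rightmost such i gives the 321-pair (i, q)
  -- of F with middle p; in G the pair (i, p) is no pattern pair by maximality.
  new-pair-left : ∀ {i₀} → i₀ ≺ p × suc k < G i₀ → NewPair
  new-pair-left start with maximiser (λ i → (i ≺? p) ×-dec (suc k <? G i)) toℕ start
  ... | i , (i≺p , k+1<Gi) , rightmost = i , q , pair , fresh
    where
    i≢p : i ≢ p
    i≢p = ≺-≢ i≺p
    i≢q : i ≢ q
    i≢q = ≺-≢ (<-trans i≺p p≺q)
    pair : WallPair k F i q
    pair = inj₁ (subst (k <_) (sym (F-elsewhere i≢p i≢q)) (<-trans (n<1+n k) k+1<Gi) ,
                 subst (_≤ k) (sym F-at-q) ≤-refl , p , i≺p , p≺q ,
                 subst₂ _<_ (sym F-at-q) (sym F-at-p) (n<1+n k) ,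
                 subst₂ _<_ (sym F-at-p) (sym (F-elsewhere i≢p i≢q)) k+1<Gi)
    not-old : ¬ WallPair k G i p
    not-old (inj₁ (_ , _ , m , i≺m , m≺p , Gp<Gm , _)) =
      <⇒≱ i≺m (rightmost m (m≺p , ≤∧≢⇒< (subst (_< G m) Gp≡k Gp<Gm)
        λ k+1≡Gm → ≺-≢ (<-trans m≺p p≺q) (G-injective (trans (sym k+1≡Gm) (sym Gq≡k+1)))))
    not-old (inj₂ (_ , _ , u , _ , i≺u , u≺v , v≺p , Gi<Gu , _)) =
      <⇒≱ i≺u (rightmost u (<-trans u≺v v≺p , <-trans k+1<Gi Gi<Gu))
    fresh : ¬ WallPair k G (τ i) (τ q)
    fresh old = not-old (subst₂ (WallPair k G) (transpose-other i≢p i≢q) (transpose-right p q) old)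

  -- Mirror image: if some j ≻ q has G j < k, the leftmost such j gives the
  -- 321-pair (p, j) of F with middle q.
  new-pair-right : ∀ {j₀} → q ≺ j₀ × G j₀ < k → NewPair
  new-pair-right start with minimiser (λ j → (q ≺? j) ×-dec (G j <? k)) toℕ start
  ... | j , (q≺j , Gj<k) , leftmost = p , j , pair , fresh
    where
    j≢p : j ≢ p
    j≢p = ≺-≢ (<-trans p≺q q≺j) ∘ sym
    j≢q : j ≢ q
    j≢q = ≺-≢ q≺j ∘ sym
    pair : WallPair k F p j
    pair = inj₁ (subst (k <_) (sym F-at-p) (n<1+n k) ,
                 subst (_≤ k) (sym (F-elsewhere j≢p j≢q)) (<⇒≤ Gj<k) , q , p≺q , q≺j ,
                 subst₂ _<_ (sym (F-elsewhere j≢p j≢q)) (sym F-at-q) Gj<k ,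
                 subst₂ _<_ (sym F-at-q) (sym F-at-p) (n<1+n k))
    not-old : ¬ WallPair k G q j
    not-old (inj₁ (_ , _ , m , q≺m , m≺j , _ , Gm<Gq)) =
      <⇒≱ m≺j (leftmost m (q≺m , ≤∧≢⇒< (≤-pred (subst (G m <_) Gq≡k+1 Gm<Gq))
        λ Gm≡k → ≺-≢ (<-trans p≺q q≺m) (G-injective (trans Gp≡k (sym Gm≡k)))))
    not-old (inj₂ (_ , _ , _ , v , q≺u , u≺v , v≺j , _ , Gv<Gj)) =
      <⇒≱ v≺j (leftmost v (<-trans q≺u u≺v , <-trans Gv<Gj Gj<k))
    fresh : ¬ WallPair k G (τ p) (τ j)
    fresh old = not-old (subst₂ (WallPair k G) (transpose-left p q) (transpose-other j≢p j≢q) old)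

  -- Otherwise all i ≺ p have G i ≤ k+1 and all j ≻ q have G j ≥ k, so a crossing
  -- (x, y) of G lies strictly between p and q and F has the 3412-pair (p, q) with
  -- inner entries x, y; its preimage (τ p, τ q) = (q, p) is not even ordered.
  new-pair-inner : (∀ i → i ≺ p → G i ≤ suc k) → (∀ j → q ≺ j → k ≤ G j) → Crossing k G → NewPair
  new-pair-inner left-low right-high (x , y , x≺y , kx , yk) = p , q , pair , fresh
    where
    x≢q : x ≢ q
    x≢q refl = <-asym p≺q (subst (q ≺_) (G-injective (trans (≤-antisym yk (right-high y x≺y)) (sym Gp≡k))) x≺y)
    k+1<Gx : suc k < G x
    k+1<Gx = ≤∧≢⇒< kx λ k+1≡Gx → x≢q (G-injective (trans (sym k+1≡Gx) (sym Gq≡k+1)))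
    p≺x : p ≺ x
    p≺x with <-cmp (toℕ x) (toℕ p)
    ... | tri< x≺p _ _ = ⊥-elim (<⇒≱ k+1<Gx (left-low x x≺p))
    ... | tri≈ _ x≡p _ = ⊥-elim (above-≢p kx (Fin.toℕ-injective x≡p))
    ... | tri> _ _ p≺x = p≺x
    Gy<k : G y < k
    Gy<k = ≤∧≢⇒< yk λ Gy≡k → <-asym p≺x (subst (x ≺_) (G-injective (trans Gy≡k (sym Gp≡k))) x≺y)
    y≺q : y ≺ q
    y≺q with <-cmp (toℕ y) (toℕ q)
    ... | tri< y≺q _ _ = y≺q
    ... | tri≈ _ y≡q _ = ⊥-elim (below-≢q yk (Fin.toℕ-injective y≡q))
    ... | tri> _ _ q≺y = ⊥-elim (<⇒≱ Gy<k (right-high y q≺y))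
    Fx≡Gx : F x ≡ G x
    Fx≡Gx = F-elsewhere (≺-≢ p≺x ∘ sym) x≢q
    Fy≡Gy : F y ≡ G y
    Fy≡Gy = F-elsewhere (λ y≡p → <-irrefl (trans (cong G y≡p) Gp≡k) Gy<k) (≺-≢ y≺q)
    pair : WallPair k F p q
    pair = inj₂ (subst (k <_) (sym F-at-p) (n<1+n k) , subst (_≤ k) (sym F-at-q) ≤-refl ,
                 x , y , p≺x , x≺y , y≺q ,
                 subst₂ _<_ (sym F-at-p) (sym Fx≡Gx) k+1<Gx ,
                 subst₂ _<_ (sym Fy≡Gy) (sym F-at-q) Gy<k)
    fresh : ¬ WallPair k G (τ p) (τ q)
    fresh old = <-asym p≺q (subst₂ _≺_ (transpose-left p q) (transpose-right p q) (wallPair-ordered k G old))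

  new-pair : Crossing k G → NewPair
  new-pair crossing with any? (λ i → (i ≺? p) ×-dec (suc k <? G i))
  ... | yes (_ , left) = new-pair-left left
  ... | no no-left with any? (λ j → (q ≺? j) ×-dec (G j <? k))
  ...   | yes (_ , right) = new-pair-right right
  ...   | no no-right = new-pair-inner (λ i i≺p → ≮⇒≥ λ k+1<Gi → no-left (i , i≺p , k+1<Gi))
                                       (λ j q≺j → ≮⇒≥ λ Gj<k → no-right (j , q≺j , Gj<k)) crossing

  private
    moves : ∀ x → Holds (decide (wallPair? k G)) x → Holds (decide (wallPair? k F)) (transposePair p q x)
    moves (x , y) h = decided⁺ (wallPair? k F) (wallPair-moves (decided⁻ (wallPair? k G) h))

  wallPairs-move : wallPairs k G ≤ wallPairs k F
  wallPairs-move = countPairs-injection (transposePair p q) moves (λ _ _ _ _ → transposePair-injective p q)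

  wallPairs-grow : Crossing k G → suc (wallPairs k G) ≤ wallPairs k F
  wallPairs-grow crossing with new-pair crossing
  ... | x , y , pair , fresh =
    countPairs-injection⁺ (transposePair p q) (transposePair-injective p q) moves (τ x , τ y)
      (fresh ∘ decided⁻ (wallPair? k G))
      (decided⁺ (wallPair? k F) (subst₂ (WallPair k F) (sym (transpose-involutive p q x)) (sym (transpose-involutive p q y)) pair))

  -- Since F crosses the wall at (p, q), the potential of F exceeds that of G.
  potential-grows : suc (potential k G) ≤ potential k F
  potential-grows = by-cases (crossing? k G)
    where
    open ≤-Reasoning
    by-cases : Dec (Crossing k G) → suc (potential k G) ≤ potential k F
    by-cases (yes crossing) = begin
      suc (wallPairs k G + crossed k G)   ≡⟨ cong (λ c → suc (wallPairs k G + c)) (crossed-yes k G crossing) ⟩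
      suc (wallPairs k G) + 1             ≤⟨ +-monoˡ-≤ 1 (wallPairs-grow crossing) ⟩
      wallPairs k F + 1                   ≡⟨ cong (wallPairs k F +_) (sym (crossed-yes k F crossing-created)) ⟩
      potential k F                       ∎
    by-cases (no no-crossing) = begin
      suc (wallPairs k G + crossed k G)   ≡⟨ cong (λ c → suc (wallPairs k G + c)) (crossed-no k G no-crossing) ⟩
      suc (wallPairs k G + 0)             ≡⟨ cong suc (+-identityʳ (wallPairs k G)) ⟩
      suc (wallPairs k G)                 ≤⟨ s≤s wallPairs-move ⟩
      suc (wallPairs k F)                 ≡⟨ +-comm 1 (wallPairs k F) ⟩
      wallPairs k F + 1                   ≡⟨ cong (wallPairs k F +_) (sym (crossed-yes k F crossing-created)) ⟩
      potential k F                       ∎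

potential-step : ∀ {n} (G : Fin n → ℕ) → Injective _≡_ _≡_ G → ∀ k a → Ascent G a →
  hit k a + potential k G ≤ potential k (swapℕ a ∘ G)
potential-step G G-injective k a (p , q , p≺q , Gp≡a , Gq≡a+1) with a ≟ k
... | yes refl = subst (_≤ potential k (swapℕ k ∘ G)) (cong (_+ potential k G) (sym (hit-same k)))
                   (AtWall.potential-grows G G-injective k p≺q Gp≡a Gq≡a+1)
... | no a≢k = subst (_≤ potential k (swapℕ a ∘ G)) (cong (_+ potential k G) (sym (hit-other a≢k)))
                 (+-mono-≤ (countPairs-mono survives) crossed-survive)
  where
  open Letter G G-injective a p≺q Gp≡a Gq≡a+1
  open OffWall k a≢k
  survives : ∀ x → Holds (decide (wallPair? k G)) x → Holds (decide (wallPair? k F)) x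
  survives (x , y) h = decided⁺ (wallPair? k F) (wallPair-survives (decided⁻ (wallPair? k G) h))
  crossed-survive : crossed k G ≤ crossed k F
  crossed-survive with crossing? k G
  ... | yes crossing = ≤-reflexive (sym (crossed-yes k F (crossing-survives crossing)))
  ... | no _         = z≤n

-- Along a length-additive word each letter σ_k raises the potential, so the
-- potential of the resulting sequence bounds the number of σ_k's.
countLetter≤potential : ∀ {n} k ws → length ws ≡ inversions (oneLine {n} ws) →
  countLetter k ws ≤ potential k (oneLine {n} ws)
countLetter≤potential k [] _ = z≤n
countLetter≤potential {n} k (a ∷ as) additive =
  ≤-trans (+-monoʳ-≤ (hit k a) (countLetter≤potential {n} k as tail-additive))
          (potential-step G (oneLine-injective as) k a ascent)
  where
  G : Fin n → ℕ
  G = oneLine as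
  tail-additive : length as ≡ inversions G
  tail-additive = ≤-antisym
    (≤-pred (subst (_≤ suc (inversions G)) (sym additive) (inversions-swap≤ G (oneLine-injective as) a)))
    (inversions≤length {n} as)
  ascent : Ascent G a
  ascent = inversions-swap-ascent G (oneLine-injective as) a (trans (sym additive) (cong suc tail-additive))

infixr 6 _∧ᵀ_
_∧ᵀ_ : ∀ {b c} → T b → T c → T (b ∧ c)
tb ∧ᵀ tc = Equivalence.from T-∧ (tb , tc)

∨ᵀ-left : ∀ {b c} → T b → T (b ∨ c)
∨ᵀ-left tb = Equivalence.from T-∨ (inj₁ tb)

∨ᵀ-right : ∀ {b c} → T c → T (b ∨ c)
∨ᵀ-right tc = Equivalence.from T-∨ (inj₂ tc)

anyᵀ : ∀ {n} (p : Fin n → Bool) (x : Fin n) → T (p x) → T (any p (allFin n))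
anyᵀ p x px = any⁺ p (Any.map (λ { refl → px }) (∈-allFin x))

<ᵀ : ∀ {m n} → m < n → T (m <ᵇ n)
<ᵀ = <⇒<ᵇ

≤ᵀ : ∀ {m n} → m ≤ n → T (m ≤ᵇ n)
≤ᵀ = ≤⇒≤ᵇ

module _ {n : ℕ} (w : Permutation′ n) (k : ℕ) where

  private
    pos : Fin n → Fin n
    pos x = w ⟨$⟩ˡ x

    value-order : ∀ {x y} → x ≺ y → T (val w (pos x) <ᵇ val w (pos y))
    value-order i≺j = <ᵀ (subst₂ _<_ (sym (cong toℕ (inverseʳ w))) (sym (cong toℕ (inverseʳ w))) i≺j)

  -- A pattern pair (x, y) of w⁻¹ at k is the position pair (w⁻¹ y, w⁻¹ x) of w:
  -- a 321 of w⁻¹ is a 321 of w, and outer entries of a 3412 of w⁻¹ are inner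
  -- positions of a 3412 of w.
  wallPair⇒posPair : ∀ {x y} → WallPair k (values (flip w)) x y → T (isPosPair k w (pos y) (pos x))
  wallPair⇒posPair (inj₁ (kx , yk , m , x≺m , m≺y , ym , mx)) = ∨ᵀ-left
    (<ᵀ yk ∧ᵀ ≤ᵀ (≤-pred kx) ∧ᵀ anyᵀ _ (pos m)
      (<ᵀ (≤-pred ym) ∧ᵀ <ᵀ (≤-pred mx) ∧ᵀ value-order m≺y ∧ᵀ value-order x≺m))
  wallPair⇒posPair {x} {y} (inj₂ (kx , yk , u , v , x≺u , u≺v , v≺y , xu , vy)) = ∨ᵀ-right {posPair321 k w (pos y) (pos x)}
    (<ᵀ yk ∧ᵀ ≤ᵀ (≤-pred kx) ∧ᵀ anyᵀ _ (pos v) (anyᵀ _ (pos u)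
      (<ᵀ (≤-pred vy) ∧ᵀ <ᵀ (≤-pred xu) ∧ᵀ value-order x≺u ∧ᵀ value-order u≺v ∧ᵀ value-order v≺y)))

  wallPairs≤PosPair : wallPairs k (values (flip w)) ≤ PosPair k w
  wallPairs≤PosPair = countPairs-injection (λ (x , y) → pos y , pos x) to-posPair
    λ _ _ _ _ e → cong₂ _,_ (inverse-injective w (cong proj₂ e)) (inverse-injective w (cong proj₁ e))
    where
    to-posPair : ∀ x → Holds (decide (wallPair? k (values (flip w)))) x → Holds (isPosPair k w) (pos (proj₂ x) , pos (proj₁ x))
    to-posPair (x , y) h = wallPair⇒posPair (decided⁻ (wallPair? k (values (flip w))) h)

module _ {n : ℕ} (w : Permutation′ n) (k : ℕ) where

  private
    G : Fin n → ℕ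
    G = values w

    ≺-irrefl : ∀ {i j : Fin n} → i ≡ j → ¬ i ≺ j
    ≺-irrefl refl i≺i = <-irrefl refl i≺i

    same-value : ∀ {i j} → G i ≡ G j → i ≡ j
    same-value = values-injective w

  -- For a 3412-pair (x, y) of G: the possible 4s (upper entries u, each followed
  -- by a possible 1) and the possible 1s after a chosen t.
  Upper : Fin n → Fin n → Fin n → Set
  Upper x y u = x ≺ u × u ≺ y × G x < G u × Σ (Fin n) λ v → u ≺ v × v ≺ y × G v < G y

  Lower : Fin n → Fin n → Fin n → Set
  Lower y t v = t ≺ v × v ≺ y × G v < G y

  -- The canonical inner pair (t, b) of the 3412-pair (x, y): t the upper entry of
  -- least value, then b the lower entry after t of greatest value.
  Canonical : Fin n → Fin n → Fin n → Fin n → Set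
  Canonical x y t b = Pattern3412 k G x y
                    × (Upper x y t × (∀ u → Upper x y u → G t ≤ G u))
                    × (Lower y t b × (∀ v → Lower y t v → G v ≤ G b))

  canonical : ∀ {x y} → Pattern3412 k G x y → Σ (Fin n) λ t → Σ (Fin n) λ b → Canonical x y t b
  canonical {x} {y} p3412@(_ , _ , u , v , x≺u , u≺v , v≺y , xu , vy)
    with minimiser (λ u → (x ≺? u) ×-dec (u ≺? y) ×-dec (G x <? G u) ×-dec
                          any? λ v → (u ≺? v) ×-dec (v ≺? y) ×-dec (G v <? G y))
                   G (x≺u , <-trans u≺v v≺y , xu , v , u≺v , v≺y , vy)
  ... | t , upper@(_ , _ , _ , v′ , t≺v′ , v′≺y , v′y) , least
    with maximiser (λ v → (t ≺? v) ×-dec (v ≺? y) ×-dec (G v <? G y)) G (t≺v′ , v′≺y , v′y)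
  ... | b , lower , greatest = t , b , p3412 , (upper , least) , (lower , greatest)

  pattern321⇒valPair : ∀ {x y} → Pattern321 k G x y → T (valPair321 k w x y)
  pattern321⇒valPair (kx , yk , m , x≺m , m≺y , ym , mx) =
    <ᵀ yk ∧ᵀ ≤ᵀ (≤-pred kx) ∧ᵀ anyᵀ _ m (<ᵀ x≺m ∧ᵀ <ᵀ m≺y ∧ᵀ <ᵀ (≤-pred mx) ∧ᵀ <ᵀ (≤-pred ym))

  canonical⇒valPair : ∀ {x y t b} → Canonical x y t b → T (valPair3412 k w t b)
  canonical⇒valPair {x} {y} ((kx , yk , _) , ((x≺t , _ , xt , _) , _) , ((t≺b , b≺y , by) , _)) =
    anyᵀ _ x (anyᵀ _ y (<ᵀ x≺t ∧ᵀ <ᵀ t≺b ∧ᵀ <ᵀ b≺y ∧ᵀ <ᵀ (≤-pred by) ∧ᵀ <ᵀ yk ∧ᵀ ≤ᵀ (≤-pred kx) ∧ᵀ <ᵀ (≤-pred xt)))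

  -- A canonical pair of a pattern pair without 321 is itself no 321-pair: a middle
  -- entry m would be a better lower entry, a better upper entry, or a 321 for (x, y).
  canonical-not321 : ∀ {x y t b} → ¬ Pattern321 k G x y → Canonical x y t b → ¬ Pattern321 k G t b
  canonical-not321 {x} {y} {t} {b} no321 ((kx , yk , _) , ((x≺t , _ , _) , least) , ((t≺b , b≺y , by) , greatest))
                   (_ , _ , m , t≺m , m≺b , bm , mt) with <-cmp (G m) (G y)
  ... | tri< my _ _ = <⇒≱ bm (greatest m (t≺m , <-trans m≺b b≺y , my))
  ... | tri≈ _ m≡y _ = ≺-irrefl (same-value m≡y) (<-trans m≺b b≺y)
  ... | tri> _ _ ym with <-cmp (G m) (G x)
  ...   | tri< mx _ _ = no321 (kx , yk , m , <-trans x≺t t≺m , <-trans m≺b b≺y , ym , mx)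
  ...   | tri≈ _ m≡x _ = ≺-irrefl (sym (same-value m≡x)) (<-trans x≺t t≺m)
  ...   | tri> _ _ xm = <⇒≱ mt (least m (<-trans x≺t t≺m , <-trans m≺b b≺y , xm , b , m≺b , b≺y , by))

  canonical-left : ∀ {x y x′ y′ t b} → ¬ Pattern321 k G x y → Canonical x y t b → Canonical x′ y′ t b → ¬ x ≺ x′
  canonical-left {x} {y} {x′} {y′} {t} {b} no321 ((kx , yk , _) , (_ , least) , ((t≺b , b≺y , by) , _))
                 ((kx′ , _ , _) , ((x′≺t , _ , x′t , _) , _) , _) x≺x′ with <-cmp (G x) (G x′)
  ... | tri< xx′ _ _ = <⇒≱ x′t (least x′ (x≺x′ , x′≺y , xx′ , b , <-trans x′≺t t≺b , b≺y , by))
    where x′≺y = <-trans x′≺t (<-trans t≺b b≺y)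
  ... | tri≈ _ x≡x′ _ = ≺-irrefl (same-value x≡x′) x≺x′
  ... | tri> _ _ x′x = no321 (kx , yk , x′ , x≺x′ , <-trans x′≺t (<-trans t≺b b≺y) , ≤-<-trans yk kx′ , x′x)

  canonical-right : ∀ {x y y′ t b} → ¬ Pattern321 k G x y′ → Canonical x y t b → Canonical x y′ t b → ¬ y ≺ y′
  canonical-right {x} {y} {y′} no321′ ((kx , yk , _) , ((x≺t , _) , _) , ((t≺b , b≺y , by) , _))
                  ((_ , y′k , _) , _ , (_ , greatest′)) y≺y′ with <-cmp (G y) (G y′)
  ... | tri< yy′ _ _ = <⇒≱ by (greatest′ y (<-trans t≺b b≺y , y≺y′ , yy′))
  ... | tri≈ _ y≡y′ _ = ≺-irrefl (same-value y≡y′) y≺y′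
  ... | tri> _ _ y′y = no321′ (kx , y′k , y , <-trans x≺t (<-trans t≺b b≺y) , y≺y′ , y′y , ≤-<-trans yk kx)

  canonical-injective : ∀ {x y x′ y′ t b} → ¬ Pattern321 k G x y → ¬ Pattern321 k G x′ y′ →
    Canonical x y t b → Canonical x′ y′ t b → (x , y) ≡ (x′ , y′)
  canonical-injective {x} {y} {x′} {y′} no321 no321′ canon canon′
    with <-cmp (toℕ x) (toℕ x′)
  ... | tri< x≺x′ _ _ = ⊥-elim (canonical-left no321 canon canon′ x≺x′)
  ... | tri> _ _ x′≺x = ⊥-elim (canonical-left no321′ canon′ canon x′≺x)
  ... | tri≈ _ x≡x′ _ with Fin.toℕ-injective x≡x′
  ...   | refl with <-cmp (toℕ y) (toℕ y′)
  ...     | tri< y≺y′ _ _ = ⊥-elim (canonical-right no321′ canon canon′ y≺y′)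
  ...     | tri≈ _ y≡y′ _ = cong (x ,_) (Fin.toℕ-injective y≡y′)
  ...     | tri> _ _ y′≺y = ⊥-elim (canonical-right no321 canon′ canon y′≺y)

  image : ∀ {x y} → Dec (Pattern321 k G x y) → Dec (Pattern3412 k G x y) → Pair n
  image {x} {y} (yes _) _       = x , y
  image         (no _)  (yes s) = proj₁ (canonical s) , proj₁ (proj₂ (canonical s))
  image {x} {y} (no _)  (no _)  = x , y

  -- The image of a pattern pair is a value pair, and different pattern pairs have
  -- different images (a canonical pair is never a 321-pair itself).
  image-valPair : ∀ {x y} (d : Dec (Pattern321 k G x y)) (d′ : Dec (Pattern3412 k G x y)) →
    WallPair k G x y → T (isValPair k w (proj₁ (image d d′)) (proj₂ (image d d′)))
  image-valPair (yes p321) _          _           = ∨ᵀ-left (pattern321⇒valPair p321)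
  image-valPair (no _)     (yes p3412) _          =
    ∨ᵀ-right {valPair321 k w _ _} (canonical⇒valPair (proj₂ (proj₂ (canonical p3412))))
  image-valPair (no no321) (no _)     (inj₁ p321)  = ⊥-elim (no321 p321)
  image-valPair (no _)     (no no3412) (inj₂ p3412) = ⊥-elim (no3412 p3412)

  image-injective : ∀ {x y x′ y′} (d : Dec (Pattern321 k G x y)) (d′ : Dec (Pattern3412 k G x y))
    (e : Dec (Pattern321 k G x′ y′)) (e′ : Dec (Pattern3412 k G x′ y′)) →
    WallPair k G x y → WallPair k G x′ y′ → image d d′ ≡ image e e′ → (x , y) ≡ (x′ , y′)
  image-injective (yes _) _ (yes _) _ _ _ same = same
  image-injective (yes p321) _ (no no321′) (yes p3412′) _ _ same =
    ⊥-elim (canonical-not321 no321′ (proj₂ (proj₂ (canonical p3412′))) (subst (λ (t , b) → Pattern321 k G t b) same p321))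
  image-injective (no no321) (yes p3412) (yes p321′) _ _ _ same =
    ⊥-elim (canonical-not321 no321 (proj₂ (proj₂ (canonical p3412))) (subst (λ (t , b) → Pattern321 k G t b) (sym same) p321′))
  image-injective {x′ = x′} {y′} (no no321) (yes p3412) (no no321′) (yes p3412′) _ _ same =
    canonical-injective no321 no321′ (proj₂ (proj₂ (canonical p3412)))
      (subst₂ (Canonical x′ y′) (sym (cong proj₁ same)) (sym (cong proj₂ same)) (proj₂ (proj₂ (canonical p3412′))))
  image-injective (no no321) (no _) _ _ (inj₁ p321) _ _ = ⊥-elim (no321 p321)
  image-injective (no _) (no no3412) _ _ (inj₂ p3412) _ _ = ⊥-elim (no3412 p3412)
  image-injective (yes _) _ (no no321′) (no _) _ (inj₁ p321′) _ = ⊥-elim (no321′ p321′)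
  image-injective (yes _) _ (no _) (no no3412′) _ (inj₂ p3412′) _ = ⊥-elim (no3412′ p3412′)
  image-injective (no _) (yes _) (no no321′) (no _) _ (inj₁ p321′) _ = ⊥-elim (no321′ p321′)
  image-injective (no _) (yes _) (no _) (no no3412′) _ (inj₂ p3412′) _ = ⊥-elim (no3412′ p3412′)

  wallPairs≤ValPair : wallPairs k G ≤ ValPair k w
  wallPairs≤ValPair = countPairs-injection valueImage to-valPair injective
    where
    valueImage : Pair n → Pair n
    valueImage (x , y) = image (pattern321? k G x y) (pattern3412? k G x y)
    to-valPair : ∀ x → Holds (decide (wallPair? k G)) x → Holds (isValPair k w) (valueImage x)
    to-valPair (x , y) h = image-valPair (pattern321? k G x y) (pattern3412? k G x y) (decided⁻ (wallPair? k G) h)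
    injective : ∀ x x′ → Holds (decide (wallPair? k G)) x → Holds (decide (wallPair? k G)) x′ →
      valueImage x ≡ valueImage x′ → x ≡ x′
    injective (x , y) (x′ , y′) h h′ =
      image-injective (pattern321? k G x y) (pattern3412? k G x y) (pattern321? k G x′ y′) (pattern3412? k G x′ y′)
        (decided⁻ (wallPair? k G) h) (decided⁻ (wallPair? k G) h′)

countLetter≤wallPairs : ∀ {n} (w : Permutation′ n) k {ws} → IsReduced w ws →
  countLetter k ws ≤ wallPairs k (values w) + 1
countLetter≤wallPairs {n} w k {ws} reduced = begin
  countLetter k ws
    ≤⟨ countLetter≤potential {n} k ws (reduced-length {n} {w} {ws} reduced) ⟩
  wallPairs k G + crossed k G
    ≤⟨ +-monoʳ-≤ (wallPairs k G) (crossed≤1 k G) ⟩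
  wallPairs k G + 1
    ≤⟨ +-monoˡ-≤ 1 (wallPairs-cong k (expression-oneLine {n} {w} {ws} (proj₁ reduced))) ⟩
  wallPairs k (values w) + 1
    ∎
  where
  open ≤-Reasoning
  G : Fin n → ℕ
  G = oneLine ws

theorem4p1 : (n : ℕ) (w : Permutation′ n) (k : ℕ) → 1 ≤ k → k < n →
    (ws : List ℕ) → IsReduced w ws →
    countLetter k ws ≤ (ValPair k w ⊓ PosPair k w) + 1
theorem4p1 n w k _ _ ws reduced =
  subst (countLetter k ws ≤_) (sym (+-distribʳ-⊓ 1 (ValPair k w) (PosPair k w))) (⊓-glb by-values by-positions)
  where
  by-values : countLetter k ws ≤ ValPair k w + 1
  by-values = ≤-trans (countLetter≤wallPairs w k reduced) (+-monoˡ-≤ 1 (wallPairs≤ValPair w k))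
  -- the reversed word, reduced for w⁻¹: pattern pairs of w⁻¹ are position pairs of w.
  by-positions : countLetter k ws ≤ PosPair k w + 1
  by-positions = subst (_≤ PosPair k w + 1) (countLetter-reverse k ws)
    (≤-trans (countLetter≤wallPairs (flip w) k (reduced-reverse {n} {w} {ws} reduced)) (+-monoˡ-≤ 1 (wallPairs≤PosPair w k)))
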